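{- Let $\mathcal{R}$ be a term rewrite system that is non-overlapping and right-linear. Then $\mathrm{dc}_{\xrightarrow{\mathbf{f}}_{\mathcal{R}}}=\mathrm{dc}_{\xrightarrow{\mathbf{i}}_{\Vert\mathcal{R}}}$ and $\mathrm{rc}_{\xrightarrow{\mathbf{f}}_{\mathcal{R}}}=\mathrm{rc}_{\xrightarrow{\mathbf{i}}_{\Vert\mathcal{R}}}$.
   Context: A TRS is a countable set $\mathcal{R}$ of rules $\ell\to r$, $\ell$ non-variable, $\mathcal{V}(r)\subseteq\mathcal{V}(\ell)$. $s\xrightarrow{\mathbf{f}}_{\mathcal{R}}t$ iff $s|_\pi=\ell\sigma$, $t=s[r\sigma]_\pi$ for some position $\pi$, rule, substitution; a redex $\ell\sigma$ is innermost if all its proper subterms are normal forms. Parallel innermost rewriting: $s\xrightarrow{\mathbf{i}}_{\Vert\mathcal{R}}t$ iff there is a nonempty set $\{\pi_1,\dots,\pi_n\}$ of pairwise parallel positions of $s$, each $s|_{\pi_m}$ an innermost redex $\ell_m\sigma_m$ for some rule $\ell_m\to r_m\in\mathcal{R}$, and $t$ is obtained from $s$ by replacing each $s|_{\pi_m}$ by $r_m\sigma_m$. Derivation height $\mathrm{dh}_\to(t)=\sup\{m\mid \exists t'.\ t\to^m t'\}$; size $|x|=1$, $|f(t_1..t_k)|=1+\sum|t_i|$; $\mathrm{dc}_\to(n)=\sup\{\mathrm{dh}_\to(t)\mid|t|\le n\}$; $\mathrm{rc}_\to(n)=\sup\{\mathrm{dh}_\to(t)\mid t$ basic, $|t|\le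 n\}$, where defined symbols are roots of left-hand sides of $\mathcal{R}$, the rest are constructors, and basic terms are $f(t_1,\dots,t_k)$ with $f$ defined and each $t_i$ containing only constructors and variables ($\sup\emptyset=0$). Non-overlapping: no two rules (renamed apart) and non-variable position $\pi$ of $\ell_1$ with $\ell_1|_\pi$ unifiable with $\ell_2$ ($\pi\ne\varepsilon$ if same rule). Right-linear: no variable occurs twice in a right-hand side. -}

module Defs where

open import Level using (0ℓ)
open import Data.Nat using (ℕ; zero; suc; _+_; _≤_)
open import Data.Fin using (Fin; toℕ)
open import Data.Vec using (Vec; []; _∷_; lookup; _[_]≔_)
open import Data.Vec.Relation.Unary.All using (All)
open import Data.List using (List; []; _∷_)
open import Data.Product using (Σ; ∃; ∃-syntax; _×_; _,_)
open import Data.Sum using (_⊎_)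
open import Relation.Nullary using (¬_)
open import Relation.Unary using (Pred)
open import Relation.Binary.PropositionalEquality using (_≡_; _≢_)
open import Function using (Injective)

record Signature : Set₁ where
  field
    Sym       : Set
    arity     : Sym → ℕ
    encode    : Sym → ℕ
    encode-inj : Injective _≡_ _≡_ encode
open Signature public

data Term (S : Signature) : Set where
  var : ℕ → Term S
  fun : (f : Sym S) → Vec (Term S) (arity S f) → Term S

Subst : Signature → Set
Subst S = ℕ → Term S

Pos : Set
Pos = List ℕ

record Rule (S : Signature) : Set where
  constructor _⟶_
  field
    lhs : Term S
    rhs : Term S
open Rule public

RuleSet : Signature → Set₁
RuleSet S = Pred (Rule S) 0ℓ

module _ {S : Signature} where

  mutual
    _·_ : Term S → Subst S → Term S
    var x · σ = σ x
    fun f ts · σ = fun f (ts ·s σ)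

    _·s_ : ∀ {n} → Vec (Term S) n → Subst S → Vec (Term S) n
    [] ·s σ = []
    (t ∷ ts) ·s σ = (t · σ) ∷ (ts ·s σ)

  mutual
    size : Term S → ℕ
    size (var x) = 1
    size (fun f ts) = suc (sizes ts)

    sizes : ∀ {n} → Vec (Term S) n → ℕ
    sizes [] = 0
    sizes (t ∷ ts) = size t + sizes ts

  data SubtermAt : Term S → Pos → Term S → Set where
    here  : ∀ {t} → SubtermAt t [] t
    there : ∀ {f ts p u} (i : Fin (arity S f)) →
            SubtermAt (lookup ts i) p u →
            SubtermAt (fun f ts) (toℕ i ∷ p) u

  Occurs : ℕ → Term S → Set
  Occurs x t = ∃[ p ] SubtermAt t p (var x)

  IsVar : Term S → Set
  IsVar t = ∃[ x ] t ≡ var x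

  IsTRS : RuleSet S → Set
  IsTRS R = ∀ ρ → R ρ → ¬ IsVar (lhs ρ) × (∀ x → Occurs x (rhs ρ) → Occurs x (lhs ρ))

  module _ (R : RuleSet S) where

    data Step : Term S → Term S → Set where
      root : ∀ {ρ} (σ : Subst S) → R ρ → Step (lhs ρ · σ) (rhs ρ · σ)
      cong : ∀ {f ts u} (i : Fin (arity S f)) → Step (lookup ts i) u →
             Step (fun f ts) (fun f (ts [ i ]≔ u))

    NF : Term S → Set
    NF t = ∀ u → ¬ Step t u

    ProperSubtermsNF : Term S → Set
    ProperSubtermsNF t = ∀ p u → SubtermAt t p u → p ≢ [] → NF u

    -- parallel innermost step  s →i_{∥R} t : a nonempty set of pairwise
    -- parallel positions, each holding an innermost redex, all contracted.
    -- (inductive description: either the root is the only position, or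
    -- the positions all lie strictly below the root, at least one of them.)
    data ParStep : Term S → Term S → Set where
      root : ∀ {ρ} (σ : Subst S) → R ρ → ProperSubtermsNF (lhs ρ · σ) →
             ParStep (lhs ρ · σ) (rhs ρ · σ)
      cong : ∀ {f} {ts us : Vec (Term S) (arity S f)} →
             (∀ i → (lookup ts i ≡ lookup us i) ⊎ ParStep (lookup ts i) (lookup us i)) →
             (∃[ i ] ParStep (lookup ts i) (lookup us i)) →
             ParStep (fun f ts) (fun f us)

    Defined : Sym S → Set
    Defined f = ∃[ ρ ] R ρ × ∃[ ts ] lhs ρ ≡ fun f ts

    ConstructorTerm : Term S → Set
    ConstructorTerm t = ∀ p g us → SubtermAt t p (fun g us) → ¬ Defined g

    Basic : Term S → Set
    Basic t = ∃[ f ] ∃[ ts ] (t ≡ fun f ts × Defined f × All ConstructorTerm ts)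

    -- Non-overlapping: no rules ρ₁, ρ₂ ∈ R (renamed apart, modelled by two
    -- independent substitutions) and non-variable position π of ℓ₁
    -- (π ≠ ε if ρ₁ = ρ₂) with ℓ₁|π unifiable with ℓ₂.
    NonOverlapping : Set
    NonOverlapping = ∀ ρ₁ ρ₂ → R ρ₁ → R ρ₂ → ∀ π u → SubtermAt (lhs ρ₁) π u →
                     ¬ IsVar u → (ρ₁ ≡ ρ₂ → π ≢ []) →
                     ¬ (∃[ σ₁ ] ∃[ σ₂ ] (u · σ₁ ≡ lhs ρ₂ · σ₂))

    RightLinear : Set
    RightLinear = ∀ ρ → R ρ → ∀ x p q → SubtermAt (rhs ρ) p (var x) →
                  SubtermAt (rhs ρ) q (var x) → p ≡ q

  -- Derivation height, derivational and runtime complexity, valued in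
  -- ℕ ∪ {∞}.  Such a supremum is determined by its natural-number upper
  -- bounds, so we define "value ≤ k" literally as "k bounds the set".

  data Iter (_⇒_ : Term S → Term S → Set) : ℕ → Term S → Term S → Set where
    done : ∀ {t} → Iter _⇒_ zero t t
    step : ∀ {m s t u} → s ⇒ t → Iter _⇒_ m t u → Iter _⇒_ (suc m) s u

  dh≤ : (Term S → Term S → Set) → Term S → ℕ → Set
  dh≤ _⇒_ t k = ∀ m t′ → Iter _⇒_ m t t′ → m ≤ k

  dc≤ : (Term S → Term S → Set) → ℕ → ℕ → Set
  dc≤ _⇒_ n k = ∀ t → size t ≤ n → dh≤ _⇒_ t k

  rc≤ : RuleSet S → (Term S → Term S → Set) → ℕ → ℕ → Set
  rc≤ R _⇒_ n k = ∀ t → Basic R t → size t ≤ n → dh≤ _⇒_ t k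

  SameComplexity : (ℕ → ℕ → Set) → (ℕ → ℕ → Set) → Set
  SameComplexity c₁ c₂ = ∀ n k → (c₁ n k → c₂ n k) × (c₂ n k → c₁ n k)

-- Every parallel innermost step is a nonempty sequence of full steps, so full derivations are at
-- least as long. Conversely, let u →i v be an innermost step and u →f u₁ any step. Then either
-- v →f* u₁, or v →f⁺ v′ with u₁ →i v′. The only nontrivial case is a redex above the innermost
-- step: non-overlap puts the innermost step inside the matching substitution, and right-linearity
-- copies it at most once into the contractum. Hence an innermost step never shortens the longest
-- remaining full derivation, so every full derivation of length m can be replaced by an innermost
-- one of length m, and single innermost steps are parallel innermost steps. Finding an innermost
-- redex and comparing rules are classical, so the argument runs in the double-negation monad; this
-- suffices because the conclusion m ≤ k is decidable.

module Submission where

open import Defs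
open import Level using (0ℓ)
open import Data.Empty using (⊥-elim)
open import Data.Unit using (⊤; tt)
open import Data.Nat using (ℕ; zero; suc; _+_; _≤_; _<_; s≤s; z≤n; _≤?_) renaming (_≟_ to _≟ⁿ_)
open import Data.Nat.Properties using (≤-refl; ≤-trans; m≤m+n; m≤n+m; n≤1+n)
open import Data.Nat.Induction using (<-wellFounded)
open import Induction.WellFounded using (Acc; acc)
open import Data.Fin using (Fin; toℕ) renaming (zero to fzero; suc to fsuc)
open import Data.Fin.Properties using (toℕ-injective) renaming (_≟_ to _≟ᶠ_)
open import Data.Vec using (Vec; []; _∷_; lookup; _[_]≔_)
open import Data.Vec.Properties using (lookup∘update; lookup∘update′; []≔-idempotent; []≔-commutes; []≔-lookup)
open import Data.Vec.Relation.Binary.Pointwise.Extensional using (ext; Pointwise-≡⇒≡)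
open import Data.List using ([]; _∷_)
open import Data.List.Properties using (∷-injective)
open import Data.Product using (_×_; ∃-syntax; _,_; proj₁; proj₂; map₂)
open import Data.Sum using (_⊎_; inj₁; inj₂)
open import Function using (id; _∘_)
open import Relation.Nullary using (¬_; Dec; yes; no)
open import Relation.Nullary.Decidable using (¬¬-excluded-middle; decidable-stable)
open import Relation.Nullary.Negation using (¬¬-Monad; ¬¬-map)
open import Relation.Unary using (Pred)
open import Relation.Binary.PropositionalEquality as ≡ using (_≡_; _≢_; refl; sym; trans; subst; subst₂; cong₂)
open import Effect.Monad using (RawMonad)
open RawMonad (¬¬-Monad {0ℓ}) using (_>>=_; return)

module _ {S : Signature} where

  private
    Tm : Set
    Tm = Term S

  Runs : (Tm → Tm → Set) → ℕ → Tm → Set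
  Runs _⇒_ m s = ∃[ t ] Iter _⇒_ m s t

  module _ {_⇒_ : Tm → Tm → Set} where

    infixr 5 _◅◅_

    _◅◅_ : ∀ {m n s t u} → Iter _⇒_ m s t → Iter _⇒_ n t u → Iter _⇒_ (m + n) s u
    done ◅◅ q = q
    step x p ◅◅ q = step x (p ◅◅ q)

    _▻_ : ∀ {m s t u} → Iter _⇒_ m s t → t ⇒ u → Iter _⇒_ (suc m) s u
    done ▻ y = step y done
    step x p ▻ y = step x (p ▻ y)

    take : ∀ {m n s t} → m ≤ n → Iter _⇒_ n s t → Runs _⇒_ m s
    take z≤n _ = _ , done
    take (s≤s m≤n) (step x p) = map₂ (step x) (take m≤n p)

  Iter-map : ∀ {A B : Tm → Tm → Set} (C : Tm → Tm) → (∀ {s t} → A s t → B (C s) (C t)) →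
             ∀ {m s t} → Iter A m s t → Iter B m (C s) (C t)
  Iter-map C g done = done
  Iter-map C g (step x p) = step (g x) (Iter-map C g p)

  lookup-·s : ∀ {n} (ts : Vec Tm n) i (σ : Subst S) → lookup (ts ·s σ) i ≡ lookup ts i · σ
  lookup-·s (t ∷ ts) fzero σ = refl
  lookup-·s (t ∷ ts) (fsuc i) σ = lookup-·s ts i σ

  fun-injective : ∀ {f} {ts us : Vec Tm (arity S f)} → fun f ts ≡ fun f us → ts ≡ us
  fun-injective refl = refl

  size-lookup : ∀ {n} (ts : Vec Tm n) i → size (lookup ts i) ≤ sizes ts
  size-lookup (t ∷ ts) fzero = m≤m+n (size t) (sizes ts)
  size-lookup (t ∷ ts) (fsuc i) = ≤-trans (size-lookup ts i) (m≤n+m (sizes ts) (size t))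

  size-subterm : ∀ {t p u} → SubtermAt t p u → size u ≤ size t
  size-subterm here = ≤-refl
  size-subterm (there {ts = ts} i occ) = ≤-trans (size-subterm occ) (≤-trans (size-lookup ts i) (n≤1+n _))

  size-proper-subterm : ∀ {t p u} → SubtermAt t p u → p ≢ [] → size u < size t
  size-proper-subterm here p≢[] = ⊥-elim (p≢[] refl)
  size-proper-subterm (there {ts = ts} i occ) _ = s≤s (≤-trans (size-subterm occ) (size-lookup ts i))

  ·-vars-agree : ∀ {t x} {σ₁ σ₂ : Subst S} → Occurs x t → t · σ₁ ≡ t · σ₂ → σ₁ x ≡ σ₂ x
  ·-vars-agree (_ , here) e = e
  ·-vars-agree {σ₁ = σ₁} {σ₂} (_ , there {ts = ts} i occ) e = ·-vars-agree (_ , occ) (begin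
    lookup ts i · σ₁      ≡⟨ lookup-·s ts i σ₁ ⟨
    lookup (ts ·s σ₁) i   ≡⟨ ≡.cong (λ us → lookup us i) (fun-injective e) ⟩
    lookup (ts ·s σ₂) i   ≡⟨ lookup-·s ts i σ₂ ⟩
    lookup ts i · σ₂      ∎)
    where open ≡.≡-Reasoning

  module _ {σ₁ σ₂ : Subst S} where
    mutual
      ·-cong-vars : ∀ t → (∀ x → Occurs x t → σ₁ x ≡ σ₂ x) → t · σ₁ ≡ t · σ₂
      ·-cong-vars (var x) agree = agree x (_ , here)
      ·-cong-vars (fun f ts) agree =
        ≡.cong (fun f) (·s-cong-vars ts λ x i (_ , occ) → agree x (_ , there i occ))

      ·s-cong-vars : ∀ {n} (ts : Vec Tm n) → (∀ x i → Occurs x (lookup ts i) → σ₁ x ≡ σ₂ x) →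
                     ts ·s σ₁ ≡ ts ·s σ₂
      ·s-cong-vars [] _ = refl
      ·s-cong-vars (t ∷ ts) agree =
        cong₂ _∷_ (·-cong-vars t λ x → agree x fzero) (·s-cong-vars ts λ x i → agree x (fsuc i))

  infixl 30 _[_↦_]

  _[_↦_] : Subst S → ℕ → Tm → Subst S
  (σ [ x ↦ b ]) y with y ≟ⁿ x
  ... | yes _ = b
  ... | no _ = σ y

  [↦]-same : ∀ σ x b → (σ [ x ↦ b ]) x ≡ b
  [↦]-same σ x b with x ≟ⁿ x
  ... | yes _ = refl
  ... | no x≢x = ⊥-elim (x≢x refl)

  [↦]-other : ∀ σ b {x y} → y ≢ x → (σ [ x ↦ b ]) y ≡ σ y
  [↦]-other σ b {x} {y} y≢x with y ≟ⁿ x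
  ... | yes y≡x = ⊥-elim (y≢x y≡x)
  ... | no _ = refl

  [↦]-fresh : ∀ σ b {x} t → ¬ Occurs x t → t · σ [ x ↦ b ] ≡ t · σ
  [↦]-fresh σ b t x∉t = ·-cong-vars t λ y y∈t → [↦]-other σ b λ { refl → x∉t y∈t }

  module _ (R : RuleSet S) where

    -- The source appears only through an equation, so that two steps out of the same term can be
    -- matched against each other; Admissible s restricts which redexes s may be contracted.
    data RewriteStep (Admissible : Pred Tm 0ℓ) : Tm → Tm → Set where
      at-root : ∀ {ρ s} (σ : Subst S) → R ρ → s ≡ lhs ρ · σ → Admissible s →
                RewriteStep Admissible s (rhs ρ · σ)
      below : ∀ {f ts s a} (i : Fin (arity S f)) → s ≡ fun f ts →
              RewriteStep Admissible (lookup ts i) a → RewriteStep Admissible s (fun f (ts [ i ]≔ a))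

    infix 4 _⟶ᶠ_ _⟶ⁱ_ _⟶ᶠ*_ _⟶ᶠ⁺_

    _⟶ᶠ_ _⟶ⁱ_ : Tm → Tm → Set
    _⟶ᶠ_ = RewriteStep (λ _ → ⊤)
    _⟶ⁱ_ = RewriteStep (ProperSubtermsNF R)

    _⟶ᶠ*_ _⟶ᶠ⁺_ : Tm → Tm → Set
    s ⟶ᶠ* t = ∃[ k ] Iter _⟶ᶠ_ k s t
    s ⟶ᶠ⁺ t = ∃[ k ] Iter _⟶ᶠ_ (suc k) s t

    ≡⇒⟶ᶠ* : ∀ {s t} → s ≡ t → s ⟶ᶠ* t
    ≡⇒⟶ᶠ* refl = 0 , done

    ⟶ᶠ⁺⇒⟶ᶠ* : ∀ {s t} → s ⟶ᶠ⁺ t → s ⟶ᶠ* t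
    ⟶ᶠ⁺⇒⟶ᶠ* (k , p) = suc k , p

    Step⇒⟶ᶠ : ∀ {s t} → Step R s t → s ⟶ᶠ t
    Step⇒⟶ᶠ (root σ ρ∈R) = at-root σ ρ∈R refl tt
    Step⇒⟶ᶠ (cong i β) = below i refl (Step⇒⟶ᶠ β)

    ⟶ᶠ⇒Step : ∀ {s t} → s ⟶ᶠ t → Step R s t
    ⟶ᶠ⇒Step (at-root σ ρ∈R refl _) = root σ ρ∈R
    ⟶ᶠ⇒Step (below i refl β) = cong i (⟶ᶠ⇒Step β)

    ⟶ⁱ⇒⟶ᶠ : ∀ {s t} → s ⟶ⁱ t → s ⟶ᶠ t
    ⟶ⁱ⇒⟶ᶠ (at-root σ ρ∈R e _) = at-root σ ρ∈R e tt
    ⟶ⁱ⇒⟶ᶠ (below i e ι) = below i e (⟶ⁱ⇒⟶ᶠ ι)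

    ⟶ⁱ⇒ParStep : ∀ {s t} → s ⟶ⁱ t → ParStep R s t
    ⟶ⁱ⇒ParStep (at-root σ ρ∈R refl proper-NF) = root σ ρ∈R proper-NF
    ⟶ⁱ⇒ParStep (below {ts = ts} {a = a} i refl ι) = cong only-i (i , at-i)
      where
      at-i : ParStep R (lookup ts i) (lookup (ts [ i ]≔ a) i)
      at-i = subst (ParStep R _) (sym (lookup∘update i ts a)) (⟶ⁱ⇒ParStep ι)
      only-i : ∀ j → lookup ts j ≡ lookup (ts [ i ]≔ a) j ⊎ ParStep R (lookup ts j) (lookup (ts [ i ]≔ a) j)
      only-i j with j ≟ᶠ i
      ... | yes refl = inj₂ at-i
      ... | no j≢i = inj₁ (sym (lookup∘update′ j≢i ts a))

    module _ {P : Pred Tm 0ℓ} where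

      below-at : ∀ f (ts : Vec Tm (arity S f)) i {a c} → RewriteStep P a c →
                 RewriteStep P (fun f (ts [ i ]≔ a)) (fun f (ts [ i ]≔ c))
      below-at f ts i {a} {c} β =
        subst (RewriteStep P _) (≡.cong (fun f) ([]≔-idempotent ts i))
              (below i refl (subst (λ z → RewriteStep P z c) (sym (lookup∘update i ts a)) β))

      step-at-subterm : ∀ {t p u v} → SubtermAt t p u → RewriteStep P u v → ∃[ t′ ] RewriteStep P t t′
      step-at-subterm here β = _ , β
      step-at-subterm (there i occ) β = _ , below i refl (proj₂ (step-at-subterm occ β))

    Iter-below : ∀ f (ts : Vec Tm (arity S f)) i {k c} → Iter _⟶ᶠ_ k (lookup ts i) c →
                 Iter _⟶ᶠ_ k (fun f ts) (fun f (ts [ i ]≔ c))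
    Iter-below f ts i {k} {c} p =
      subst (λ us → Iter _⟶ᶠ_ k (fun f us) (fun f (ts [ i ]≔ c))) ([]≔-lookup ts i)
            (Iter-map (λ a → fun f (ts [ i ]≔ a)) (below-at f ts i) p)

    ⟶ᶠ*-args : ∀ f {ts us : Vec Tm (arity S f)} → (∀ j → lookup ts j ⟶ᶠ* lookup us j) → fun f ts ⟶ᶠ* fun f us
    ⟶ᶠ*-args f = ⟶ᶠ*-context (fun f) λ ts j → map₂ (Iter-below f ts j)
      where
      -- generalised to arbitrary contexts so that the induction can peel off the head argument
      ⟶ᶠ*-context : ∀ {n} (C : Vec Tm n → Tm) → (∀ ts j {c} → lookup ts j ⟶ᶠ* c → C ts ⟶ᶠ* C (ts [ j ]≔ c)) →
                    ∀ {ts us} → (∀ j → lookup ts j ⟶ᶠ* lookup us j) → C ts ⟶ᶠ* C us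
      ⟶ᶠ*-context C C-arg {[]} {[]} _ = 0 , done
      ⟶ᶠ*-context C C-arg {t ∷ ts} {u ∷ us} args =
        let (k , head) = C-arg (t ∷ ts) fzero (args fzero)
            (l , tail) = ⟶ᶠ*-context (λ vs → C (u ∷ vs)) (λ vs j → C-arg (u ∷ vs) (fsuc j))
                                     (λ j → args (fsuc j))
        in k + l , head ◅◅ tail

    module _ {σ σ′ : Subst S} (σ⟶σ′ : ∀ y → σ y ⟶ᶠ* σ′ y) where
      mutual
        ·-⟶ᶠ* : ∀ t → t · σ ⟶ᶠ* t · σ′
        ·-⟶ᶠ* (var y) = σ⟶σ′ y
        ·-⟶ᶠ* (fun f ts) = ⟶ᶠ*-args f (·s-⟶ᶠ* ts)

        ·s-⟶ᶠ* : ∀ {n} (ts : Vec Tm n) j → lookup (ts ·s σ) j ⟶ᶠ* lookup (ts ·s σ′) j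
        ·s-⟶ᶠ* (t ∷ ts) fzero = ·-⟶ᶠ* t
        ·s-⟶ᶠ* (t ∷ ts) (fsuc j) = ·s-⟶ᶠ* ts j

    [↦]-⟶ᶠ* : ∀ {σ x b} → σ x ⟶ᶠ b → ∀ y → σ y ⟶ᶠ* (σ [ x ↦ b ]) y
    [↦]-⟶ᶠ* {x = x} σx⟶b y with y ≟ⁿ x
    ... | yes refl = 1 , step σx⟶b done
    ... | no _ = 0 , done

    OverlapFree : Tm → Set
    OverlapFree l = ∀ ρ → R ρ → ∀ π u → SubtermAt l π u → ¬ IsVar u →
                    ¬ (∃[ σ₁ ] ∃[ σ₂ ] (u · σ₁ ≡ lhs ρ · σ₂))

    -- The step lies inside some σ x; since l need not be linear, the other copies of σ x in l · σ
    -- are then caught up with by full steps.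
    mutual
      step-in-substitution : ∀ {t a} l σ → t ≡ l · σ → OverlapFree l → t ⟶ⁱ a →
                             ∃[ x ] ∃[ b ] (σ x ⟶ⁱ b × a ⟶ᶠ* l · σ [ x ↦ b ])
      step-in-substitution (var x) σ refl _ ι = x , _ , ι , ≡⇒⟶ᶠ* (sym ([↦]-same σ x _))
      step-in-substitution (fun g ls) σ e free (at-root σ₂ ρ∈R e₂ _) =
        ⊥-elim (free _ ρ∈R [] _ here (λ ()) (σ , σ₂ , trans (sym e) e₂))
      step-in-substitution (fun g ls) σ refl free (below i refl ι) =
        step-below-pattern g ls σ i (λ ρ ρ∈R π u occ → free ρ ρ∈R _ u (there i occ)) ι

      step-below-pattern : ∀ g (ls : Vec Tm (arity S g)) σ i {a} → OverlapFree (lookup ls i) →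
                           lookup (ls ·s σ) i ⟶ⁱ a →
                           ∃[ x ] ∃[ b ] (σ x ⟶ⁱ b × fun g ((ls ·s σ) [ i ]≔ a) ⟶ᶠ* fun g ls · σ [ x ↦ b ])
      step-below-pattern g ls σ i {a} free ι
        with step-in-substitution (lookup ls i) σ (lookup-·s ls i σ) free ι
      ... | x , b , σx⟶b , a⟶ = x , b , σx⟶b , ⟶ᶠ*-args g args
        where
        args : ∀ j → lookup ((ls ·s σ) [ i ]≔ a) j ⟶ᶠ* lookup (ls ·s σ [ x ↦ b ]) j
        args j with j ≟ᶠ i
        ... | yes refl = subst₂ _⟶ᶠ*_ (sym (lookup∘update j (ls ·s σ) a)) (sym (lookup-·s ls j _)) a⟶
        ... | no j≢i = subst (_⟶ᶠ* _) (sym (lookup∘update′ j≢i (ls ·s σ) a))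
                             (·s-⟶ᶠ* ([↦]-⟶ᶠ* (⟶ⁱ⇒⟶ᶠ σx⟶b)) ls j)

    Linear : ℕ → Tm → Set
    Linear x r = ∀ p q → SubtermAt r p (var x) → SubtermAt r q (var x) → p ≡ q

    step-at-linear-variable : ∀ {P : Pred Tm 0ℓ} {σ x b r p} → RewriteStep P (σ x) b → Linear x r →
                              SubtermAt r p (var x) → RewriteStep P (r · σ) (r · σ [ x ↦ b ])
    step-at-linear-variable {P} {σ} {x} {b} β lin here = subst (RewriteStep P _) (sym ([↦]-same σ x b)) β
    step-at-linear-variable {P} {σ} {x} {b} β lin (there {f = g} {ts = rs} i occ) =
      subst (RewriteStep P _) (≡.cong (fun g) (sym args-≡))
            (below i refl (subst (λ z → RewriteStep P z (lookup rs i · σ [ x ↦ b ])) (sym (lookup-·s rs i σ))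
                                 (step-at-linear-variable β lin′ occ)))
      where
      lin′ : Linear x (lookup rs i)
      lin′ p q o₁ o₂ = proj₂ (∷-injective (lin _ _ (there i o₁) (there i o₂)))
      x∉sibling : ∀ {j} → j ≢ i → ¬ Occurs x (lookup rs j)
      x∉sibling j≢i (_ , o) = j≢i (toℕ-injective (proj₁ (∷-injective (lin _ _ (there _ o) (there i occ)))))
      args-≡ : rs ·s σ [ x ↦ b ] ≡ (rs ·s σ) [ i ]≔ (lookup rs i · σ [ x ↦ b ])
      args-≡ = Pointwise-≡⇒≡ (ext arg-≡)
        where
        open ≡.≡-Reasoning
        arg-≡ : ∀ j → lookup (rs ·s σ [ x ↦ b ]) j ≡ lookup ((rs ·s σ) [ i ]≔ (lookup rs i · σ [ x ↦ b ])) j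
        arg-≡ j with j ≟ᶠ i
        ... | yes refl = trans (lookup-·s rs j _) (sym (lookup∘update j (rs ·s σ) _))
        ... | no j≢i = begin
          lookup (rs ·s σ [ x ↦ b ]) j                        ≡⟨ lookup-·s rs j _ ⟩
          lookup rs j · σ [ x ↦ b ]                            ≡⟨ [↦]-fresh σ b (lookup rs j) (x∉sibling j≢i) ⟩
          lookup rs j · σ                                      ≡⟨ lookup-·s rs j σ ⟨
          lookup (rs ·s σ) j                                   ≡⟨ lookup∘update′ j≢i (rs ·s σ) _ ⟨
          lookup ((rs ·s σ) [ i ]≔ (lookup rs i · σ [ x ↦ b ])) j ∎

    argument-NF : ∀ {f ts} → ProperSubtermsNF R (fun f ts) → ∀ i → NF R (lookup ts i)
    argument-NF proper-NF i = proper-NF (toℕ i ∷ []) _ (there i here) (λ ())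

    innermost-step-exists : ∀ {s u} → s ⟶ᶠ u → ¬ ¬ (∃[ v ] s ⟶ⁱ v)
    innermost-step-exists = descend (<-wellFounded _)
      where
      -- if some proper subterm is reducible, recurse into it; otherwise the given step is innermost
      descend : ∀ {s u} → Acc _<_ (size s) → s ⟶ᶠ u → ¬ ¬ (∃[ v ] s ⟶ⁱ v)
      descend {s} (acc smaller) α no-innermost = no-innermost (_ , innermost α)
        where
        proper-NF : ProperSubtermsNF R s
        proper-NF p t occ p≢[] t′ β =
          descend (smaller (size-proper-subterm occ p≢[])) (Step⇒⟶ᶠ β)
                  (λ (_ , ι) → no-innermost (step-at-subterm occ ι))
        innermost : ∀ {u} → s ⟶ᶠ u → s ⟶ⁱ u
        innermost (at-root σ ρ∈R e _) = at-root σ ρ∈R e proper-NF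
        innermost (below i refl β) = ⊥-elim (argument-NF proper-NF i _ (⟶ᶠ⇒Step β))

    ParStep⇒⟶ᶠ⁺ : ∀ {s t} → ParStep R s t → s ⟶ᶠ⁺ t
    ParStep⇒⟶ᶠ⁺ (root σ ρ∈R _) = 0 , step (at-root σ ρ∈R refl tt) done
    ParStep⇒⟶ᶠ⁺ (cong {f} {ts} {us} args (i , π)) =
      let (k , first) = map₂ (Iter-below f ts i) (ParStep⇒⟶ᶠ⁺ π)
          (l , rest) = ⟶ᶠ*-args f others
      in k + l , first ◅◅ rest
      where
      others : ∀ j → lookup (ts [ i ]≔ lookup us i) j ⟶ᶠ* lookup us j
      others j with j ≟ᶠ i | args j
      ... | yes refl | _ = ≡⇒⟶ᶠ* (lookup∘update j ts _)
      ... | no j≢i | inj₁ e = ≡⇒⟶ᶠ* (trans (lookup∘update′ j≢i ts _) e)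
      ... | no j≢i | inj₂ π′ = subst (_⟶ᶠ* _) (sym (lookup∘update′ j≢i ts _)) (⟶ᶠ⁺⇒⟶ᶠ* (ParStep⇒⟶ᶠ⁺ π′))

    ParStep-run⇒⟶ᶠ-run : ∀ {m s t} → Iter (ParStep R) m s t → ∃[ n ] m ≤ n × Iter _⟶ᶠ_ n s t
    ParStep-run⇒⟶ᶠ-run done = 0 , z≤n , done
    ParStep-run⇒⟶ᶠ-run (step π run) =
      let (k , first) = ParStep⇒⟶ᶠ⁺ π
          (n , m≤n , rest) = ParStep-run⇒⟶ᶠ-run run
      in suc k + n , s≤s (≤-trans m≤n (m≤n+m n k)) , first ◅◅ rest

    dh≤-Step⇒dh≤-ParStep : ∀ {t k} → dh≤ (Step R) t k → dh≤ (ParStep R) t k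
    dh≤-Step⇒dh≤-ParStep bound m t′ run =
      let (n , m≤n , run′) = ParStep-run⇒⟶ᶠ-run run
      in ≤-trans m≤n (bound n t′ (Iter-map id ⟶ᶠ⇒Step run′))

    CatchesUp : Tm → Tm → Set
    CatchesUp v u₁ = v ⟶ᶠ* u₁ ⊎ ∃[ v′ ] (v ⟶ᶠ⁺ v′ × u₁ ⟶ⁱ v′)

    CatchesUp-below : ∀ f (ts : Vec Tm (arity S f)) i {a c} → CatchesUp a c →
                      CatchesUp (fun f (ts [ i ]≔ a)) (fun f (ts [ i ]≔ c))
    CatchesUp-below f ts i (inj₁ (k , p)) = inj₁ (k , Iter-map _ (below-at f ts i) p)
    CatchesUp-below f ts i (inj₂ (_ , (k , p) , ι)) =
      inj₂ (_ , (k , Iter-map _ (below-at f ts i) p) , below-at f ts i ι)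

    module _ (trs : IsTRS R) (nov : NonOverlapping R) (rlin : RightLinear R) where

      lhs-arguments-overlap-free : ∀ {g ls r} → R (fun g ls ⟶ r) → ∀ i → OverlapFree (lookup ls i)
      lhs-arguments-overlap-free ρ∈R i ρ ρ′∈R π u occ u-nonvar =
        nov _ ρ ρ∈R ρ′∈R (toℕ i ∷ π) u (there i occ) u-nonvar λ _ ()

      redex-above-innermost-step : ∀ {l r σ f ts i a} → R (l ⟶ r) → fun f ts ≡ l · σ → lookup ts i ⟶ⁱ a →
                                   ¬ ¬ CatchesUp (fun f (ts [ i ]≔ a)) (r · σ)
      redex-above-innermost-step {var x} ρ∈R _ _ = ⊥-elim (proj₁ (trs _ ρ∈R) (x , refl))
      redex-above-innermost-step {fun g ls} {r} {σ} {i = i} {a} ρ∈R refl ι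
        with step-below-pattern g ls σ i (lhs-arguments-overlap-free ρ∈R i) ι
      ... | x , b , σx⟶b , (k , v⟶lσ′) = ¬¬-map catch-up ¬¬-excluded-middle
        where
        v⟶rσ′ : fun g ((ls ·s σ) [ i ]≔ a) ⟶ᶠ⁺ r · σ [ x ↦ b ]
        v⟶rσ′ = k , v⟶lσ′ ▻ at-root (σ [ x ↦ b ]) ρ∈R refl tt
        catch-up : Dec (Occurs x r) → CatchesUp (fun g ((ls ·s σ) [ i ]≔ a)) (r · σ)
        catch-up (yes (_ , occ)) = inj₂ (_ , v⟶rσ′ , step-at-linear-variable σx⟶b (rlin _ ρ∈R x) occ)
        catch-up (no x∉r) = inj₁ (subst (_ ⟶ᶠ*_) ([↦]-fresh σ b r x∉r) (⟶ᶠ⁺⇒⟶ᶠ* v⟶rσ′))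

      innermost-peak : ∀ {u v u₁} → u ⟶ⁱ v → u ⟶ᶠ u₁ → ¬ ¬ CatchesUp v u₁
      innermost-peak (at-root {ρ₁} σ₁ ρ₁∈R refl _) (at-root {ρ₂} σ₂ ρ₂∈R e _) caught =
        nov ρ₁ ρ₂ ρ₁∈R ρ₂∈R [] _ here (proj₁ (trs ρ₁ ρ₁∈R))
            (λ ρ₁≡ρ₂ _ → caught (inj₁ (≡⇒⟶ᶠ* (same-contractum ρ₁≡ρ₂))))
            (σ₁ , σ₂ , e)
        where
        same-contractum : ρ₁ ≡ ρ₂ → rhs ρ₁ · σ₁ ≡ rhs ρ₂ · σ₂
        same-contractum refl = ·-cong-vars (rhs ρ₁) λ x x∈r → ·-vars-agree (proj₂ (trs ρ₁ ρ₁∈R) x x∈r) e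
      innermost-peak (at-root σ ρ∈R refl proper-NF) (below i e β) =
        ⊥-elim (argument-NF (subst (ProperSubtermsNF R) e proper-NF) i _ (⟶ᶠ⇒Step β))
      innermost-peak (below i refl ι) (at-root σ ρ∈R e _) = redex-above-innermost-step ρ∈R e ι
      innermost-peak (below {f} {ts} {a = a} i refl ι) (below {a = c} j refl β) with i ≟ᶠ j
      ... | yes refl = ¬¬-map (CatchesUp-below f ts i) (innermost-peak ι β)
      ... | no i≢j = return (inj₂ (_ , (0 , step v⟶ done) , u₁⟶ⁱ))
        where
        v⟶ : fun f (ts [ i ]≔ a) ⟶ᶠ fun f ((ts [ i ]≔ a) [ j ]≔ c)
        v⟶ = below j refl (subst (_⟶ᶠ c) (sym (lookup∘update′ (i≢j ∘ sym) ts a)) β)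
        u₁⟶ⁱ : fun f (ts [ j ]≔ c) ⟶ⁱ fun f ((ts [ i ]≔ a) [ j ]≔ c)
        u₁⟶ⁱ = subst (fun f (ts [ j ]≔ c) ⟶ⁱ_) (≡.cong (fun f) ([]≔-commutes ts j i (i≢j ∘ sym)))
                     (below i refl (subst (_⟶ⁱ a) (sym (lookup∘update′ i≢j ts c)) ι))

      mutual
        innermost-step-preserves-runs : ∀ {m u v u₁ w} → u ⟶ⁱ v → u ⟶ᶠ u₁ → Iter _⟶ᶠ_ m u₁ w →
                                        ¬ ¬ Runs _⟶ᶠ_ m v
        innermost-step-preserves-runs ι α run = do
          caught ← innermost-peak ι α
          CatchesUp-preserves-runs caught run

        CatchesUp-preserves-runs : ∀ {m v u₁ w} → CatchesUp v u₁ → Iter _⟶ᶠ_ m u₁ w → ¬ ¬ Runs _⟶ᶠ_ m v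
        CatchesUp-preserves-runs {m} (inj₁ (k , v⟶u₁)) run = return (take (m≤n+m m k) (v⟶u₁ ◅◅ run))
        CatchesUp-preserves-runs (inj₂ _) done = return (_ , done)
        CatchesUp-preserves-runs (inj₂ (_ , (k , v⟶v′) , ι)) (step {m = m} α run) = do
          (_ , v′⟶) ← innermost-step-preserves-runs ι α run
          return (take (s≤s (m≤n+m m k)) (v⟶v′ ◅◅ v′⟶))

      innermost-runs : ∀ m {s t} → Iter _⟶ᶠ_ m s t → ¬ ¬ Runs _⟶ⁱ_ m s
      innermost-runs zero done = return (_ , done)
      innermost-runs (suc m) (step α run) = do
        (_ , ι) ← innermost-step-exists α
        (_ , run′) ← innermost-step-preserves-runs ι α run
        (_ , run″) ← innermost-runs m run′
        return (_ , step ι run″)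

      dh≤-ParStep⇒dh≤-Step : ∀ {t k} → dh≤ (ParStep R) t k → dh≤ (Step R) t k
      dh≤-ParStep⇒dh≤-Step {k = k} bound m _ run = decidable-stable (m ≤? k) do
        (_ , run′) ← innermost-runs m (Iter-map id Step⇒⟶ᶠ run)
        return (bound m _ (Iter-map id ⟶ⁱ⇒ParStep run′))

theorem5p11 : (S : Signature) (R : RuleSet S) → IsTRS R → NonOverlapping R → RightLinear R →
    SameComplexity {S} (dc≤ (Step R)) (dc≤ (ParStep R))
    × SameComplexity {S} (rc≤ R (Step R)) (rc≤ R (ParStep R))
theorem5p11 S R trs nov rlin =
  (λ n k → (λ bound t → full⇒par ∘ bound t) , (λ bound t → par⇒full ∘ bound t)) ,
  (λ n k → (λ bound t b → full⇒par ∘ bound t b) , (λ bound t b → par⇒full ∘ bound t b))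
  where
  full⇒par : ∀ {t k} → dh≤ (Step R) t k → dh≤ (ParStep R) t k
  full⇒par = dh≤-Step⇒dh≤-ParStep R
  par⇒full : ∀ {t k} → dh≤ (ParStep R) t k → dh≤ (Step R) t k
  par⇒full = dh≤-ParStep⇒dh≤-Step R trs nov rlin
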